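{- Let $m$ be a fixed (external) natural number. Let $A$ be a type and $C_1,\dots,C_m$ type families, where $C_j$ may depend (only) on $A$ and on $\Pi_A C_i$ for all $i<j$, so that \[ C :\equiv \Sigma_{\Pi_A C_1}\,\Sigma_{\Pi_A C_2}\cdots\Sigma_{\Pi_A C_{m-1}}\,\Pi_A C_m \] is a well-formed type. Then the types $C$ and $\|A\|\to C$ are equivalent.
   Context: Homotopy type theory with function extensionality and propositional truncation $\|A\|$ (a type any two of whose elements are equal, with $|{ - }|:A\to\|A\|$ such that precomposition gives $(\|A\|\to P)\simeq(A\to P)$ for every proposition $P$). $\Pi_A C_i$ denotes the dependent function type over $A$ and $\Sigma_X Y$ the dependent pair type. -}

module Defs where

open import Level using (Level; _⊔_) renaming (suc to lsuc)
open import Data.Nat using (ℕ; suc)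
open import Data.Product using (Σ; _×_; _,_)
open import Function using (_∘_; id)
open import Relation.Binary.PropositionalEquality using (_≡_)

isProp : ∀ {ℓ} → Set ℓ → Set ℓ
isProp X = (x y : X) → x ≡ y

_∼_ : ∀ {a b} {X : Set a} {Y : X → Set b} (f g : (x : X) → Y x) → Set (a ⊔ b)
f ∼ g = ∀ x → f x ≡ g x

-- equivalences as bi-invertible maps (HoTT book, 4.3)
isEquiv : ∀ {a b} {X : Set a} {Y : Set b} → (X → Y) → Set (a ⊔ b)
isEquiv {X = X} {Y} f =
  (Σ (Y → X) λ g → (g ∘ f) ∼ id) × (Σ (Y → X) λ h → (f ∘ h) ∼ id)

_≃_ : ∀ {a b} → Set a → Set b → Set (a ⊔ b)
X ≃ Y = Σ (X → Y) isEquiv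

record IsPropTrunc {ℓ} (A : Set ℓ) (T : Set ℓ) : Set (lsuc ℓ) where
  field
    T-isProp : isProp T
    ∣_∣ : A → T
    univ : (P : Set ℓ) → isProp P → isEquiv (λ (g : T → P) → g ∘ ∣_∣)

-- Telescope of m ≥ 1 type families C_1,...,C_m over A, where C_j may
-- depend on the previously chosen functions f_i : Π_A C_i (i < j).
-- Tel A n has exactly n families.
data Tel {ℓ} (A : Set ℓ) : ℕ → Set (lsuc ℓ) where
  last : (A → Set ℓ) → Tel A 1
  cons : ∀ {n} (C : A → Set ℓ) → (((a : A) → C a) → Tel A (suc n)) → Tel A (suc (suc n))

⟦_⟧ : ∀ {ℓ} {A : Set ℓ} {n : ℕ} → Tel A n → Set ℓ
⟦_⟧ {A = A} (last C) = (a : A) → C a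
⟦_⟧ {A = A} (cons C K) = Σ ((a : A) → C a) λ f → ⟦ K f ⟧

module Submission where

-- Write  const : X → (T → X)  for the constant-map embedding, with
-- T = ∥A∥.  Since T is a proposition, no point of T is
-- needed: it suffices to give a "collapse" map  (T → X) → X  that inverts
-- const on the left and agrees with every value g t (Collapse below).
--
--   * Collapse X makes const an equivalence (const-isEquiv).
--   * A dependent function type  Π_A Y  collapses: evaluate g at ∣ a ∣
--     and then at a.  This collapse is even coherent: on constant maps the
--     agreement path is the (trivial) left-inverse path (Π-collapse).
--   * A Σ-type collapses when its base collapses coherently and its fibres
--     collapse (Σ-collapse); coherence of the base is exactly what is
--     needed to transport the fibre data back over constant maps.
--   * By induction on the telescope every ⟦ C ⟧ collapses (Tel-collapse),
--     because each base of the iterated Σ is a Π-type over A.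

open import Defs
open import Data.Nat using (ℕ; suc)
open import Data.Product using (Σ; _,_; proj₁; proj₂)
open import Data.Product.Properties using (Σ-≡,≡→≡)
open import Function using (_∘_; const)
open import Axiom.Extensionality.Propositional using (Extensionality)
open import Relation.Binary.PropositionalEquality
  using (_≡_; refl; sym; trans; cong; subst; module ≡-Reasoning)
open import Relation.Binary.PropositionalEquality.Properties
  using (trans-symˡ; subst-subst-sym)

cong-const : ∀ {a b} {X : Set a} {Y : Set b} {y : Y} {x x′ : X} (e : x ≡ x′) →
  cong (λ _ → y) e ≡ refl
cong-const refl = refl

module _ {ℓ} (ext : Extensionality ℓ ℓ) where

  -- Function extensionality normalised so that it sends the pointwise
  -- reflexive homotopy to refl; needed for the coherence in Π-collapse.
  funext : {X : Set ℓ} {Y : X → Set ℓ} {f g : (x : X) → Y x} → f ∼ g → f ≡ g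
  funext {f = f} h = trans (sym (ext {f = f} {g = f} λ _ → refl)) (ext h)

  funext-refl : {X : Set ℓ} {Y : X → Set ℓ} {f : (x : X) → Y x} →
    funext {f = f} {g = f} (λ _ → refl) ≡ refl
  funext-refl {f = f} = trans-symˡ (ext {f = f} {g = f} λ _ → refl)

  module _ (T : Set ℓ) where

    record Collapse (X : Set ℓ) : Set ℓ where
      field
        collapse       : (T → X) → X
        collapse-const : (x : X) → collapse (const x) ≡ x
        collapse-at    : (g : T → X) (t : T) → collapse g ≡ g t

    record CoherentCollapse (X : Set ℓ) : Set ℓ where
      field
        collapsing : Collapse X
      open Collapse collapsing public
      field
        coherent : (x : X) (t : T) → collapse-at (const x) t ≡ collapse-const x

    const-isEquiv : {X : Set ℓ} → Collapse X → isEquiv (λ (x : X) (_ : T) → x)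
    const-isEquiv c = (collapse , collapse-const) , (collapse , λ g → ext (collapse-at g))
      where open Collapse c

    -- Each g t is moved into the fibre over  x₀ = collapse (proj₁ ∘ g)
    -- along the agreement path, and the fibres are collapsed there.
    Σ-collapse : {X : Set ℓ} {Y : X → Set ℓ} →
      CoherentCollapse X → ((x : X) → Collapse (Y x)) → Collapse (Σ X Y)
    Σ-collapse {X} {Y} cX cY = record
      { collapse = collapseΣ ; collapse-const = collapseΣ-const ; collapse-at = collapseΣ-at }
      where
        open CoherentCollapse cX
        module Fibre (x : X) = Collapse (cY x)

        fibres : (g : T → Σ X Y) → T → Y (collapse (proj₁ ∘ g))
        fibres g t = subst Y (sym (collapse-at (proj₁ ∘ g) t)) (proj₂ (g t))

        collapseΣ : (T → Σ X Y) → Σ X Y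
        collapseΣ g = collapse (proj₁ ∘ g) , Fibre.collapse _ (fibres g)

        collapseΣ-at : (g : T → Σ X Y) (t : T) → collapseΣ g ≡ g t
        collapseΣ-at g t = Σ-≡,≡→≡ (collapse-at (proj₁ ∘ g) t , (begin
          subst Y p (Fibre.collapse _ (fibres g))  ≡⟨ cong (subst Y p) (Fibre.collapse-at _ (fibres g) t) ⟩
          subst Y p (subst Y (sym p) (proj₂ (g t))) ≡⟨ subst-subst-sym p ⟩
          proj₂ (g t)                               ∎))
          where
            open ≡-Reasoning
            p = collapse-at (proj₁ ∘ g) t

        -- over a constant map, coherence makes the transported fibres constant
        fibres-const : (x : X) (y : Y x) →
          fibres (const (x , y)) ≡ const (subst Y (sym (collapse-const x)) y)
        fibres-const x y = ext λ t → cong (λ e → subst Y (sym e) y) (coherent x t)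

        collapseΣ-const : (xy : Σ X Y) → collapseΣ (const xy) ≡ xy
        collapseΣ-const (x , y) = Σ-≡,≡→≡ (collapse-const x , (begin
          subst Y r (Fibre.collapse _ (fibres (const (x , y))))
            ≡⟨ cong (subst Y r ∘ Fibre.collapse _) (fibres-const x y) ⟩
          subst Y r (Fibre.collapse _ (const (subst Y (sym r) y)))
            ≡⟨ cong (subst Y r) (Fibre.collapse-const _ _) ⟩
          subst Y r (subst Y (sym r) y)
            ≡⟨ subst-subst-sym r ⟩
          y ∎))
          where
            open ≡-Reasoning
            r = collapse-const x

  module _ {A T : Set ℓ} (T-isProp : isProp T) (∣_∣ : A → T) where

    -- Π_A Y collapses coherently for any proposition T receiving a map
    -- from A: the component at a is read off at ∣ a ∣, which equals every t.
    Π-collapse : (Y : A → Set ℓ) → CoherentCollapse T ((a : A) → Y a)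
    Π-collapse Y = record
      { collapsing = record
        { collapse       = λ g a → g ∣ a ∣ a
        ; collapse-const = λ _ → refl
        ; collapse-at    = collapse-at }
      ; coherent = λ f t → begin
          funext (λ a → cong (λ _ → f a) (T-isProp ∣ a ∣ t)) ≡⟨ cong funext (ext λ a → cong-const (T-isProp ∣ a ∣ t)) ⟩
          funext (λ a → refl)                               ≡⟨ funext-refl ⟩
          refl                                              ∎ }
      where
        open ≡-Reasoning
        collapse-at : (g : T → (a : A) → Y a) (t : T) → (λ a → g ∣ a ∣ a) ≡ g t
        collapse-at g t = funext λ a → cong (λ s → g s a) (T-isProp ∣ a ∣ t)

    Tel-collapse : ∀ {n} (C : Tel A n) → Collapse T ⟦ C ⟧
    Tel-collapse (last Y)   = CoherentCollapse.collapsing (Π-collapse Y)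
    Tel-collapse (cons Y K) = Σ-collapse T (Π-collapse Y) (λ f → Tel-collapse (K f))

lemma2p1 : ∀ {ℓ} → Extensionality ℓ ℓ →
    (m : ℕ) (A : Set ℓ) (∥A∥ : Set ℓ) → IsPropTrunc A ∥A∥ →
    (C : Tel A (suc m)) → ⟦ C ⟧ ≃ (∥A∥ → ⟦ C ⟧)
lemma2p1 ext m A ∥A∥ trunc C =
  const , const-isEquiv ext ∥A∥ (Tel-collapse ext T-isProp ∣_∣ C)
  where open IsPropTrunc trunc
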